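{- Let $\lambda$ be a nonzero real number. For any integers $m,n\ge 0$, $$\binom{n+m}{n}H_{n+m,\lambda}=\sum_{l=0}^{n}H_{l,\lambda}\binom{m+n-l-1}{n-l}+H_{m,\lambda}\binom{m+n-\lambda}{n},$$ where $H_{j,\lambda}$ denotes the $j$-th degenerate harmonic number.
   Context: For nonzero real $\lambda$, the degenerate harmonic numbers are defined by $H_{0,\lambda}=0$ and, for $j\ge1$, $H_{j,\lambda}=\frac{1}{\lambda}\sum_{k=1}^{j}\binom{\lambda}{k}(-1)^{k-1}=\sum_{k=1}^{j}\binom{\lambda-1}{k-1}\frac{(-1)^{k-1}}{k}$. Equivalently, $\frac{1}{1-t}\log_{ -\lambda}\!\left(\frac{1}{1-t}\right)=\sum_{j\ge1}H_{j,\lambda}t^j$, where $\log_{\mu}(t)=\frac{1}{\mu}(t^{\mu}-1)$ is the degenerate logarithm. Binomial coefficients are the generalized ones: for any real $x$ and integer $j\ge0$, $\binom{x}{j}=\frac{x(x-1)\cdots(x-j+1)}{j!}$, with $\binom{x}{0}=1$ (so e.g. $\binom{ -1}{0}=1$). -}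

module Defs where

open import Level using (Level)
open import Algebra.Bundles using (CommutativeRing)
open import Data.Nat using (ℕ; zero; suc)
open import Data.Nat.Base using (_!)

-- Degenerate harmonic numbers over a commutative ring R in which positive
-- integers are invertible (inv k is meant to be 1/k for k ≥ 1; this is a
-- hypothesis of the theorem, not built in here).
module Degenerate {c ℓ : Level} (R : CommutativeRing c ℓ) (inv : ℕ → CommutativeRing.Carrier R) where
  open CommutativeRing R hiding (zero)

  ι : ℕ → Carrier
  ι zero    = 0#
  ι (suc n) = 1# + ι n

  fall : Carrier → ℕ → Carrier
  fall x zero    = 1#
  fall x (suc j) = fall x j * (x - ι j)

  binom : Carrier → ℕ → Carrier
  binom x j = fall x j * inv (j !)

  sgn : ℕ → Carrier
  sgn zero    = 1#
  sgn (suc k) = - sgn k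

  H : Carrier → ℕ → Carrier
  H lam zero    = 0#
  H lam (suc j) = H lam j + (binom (lam - 1#) j * sgn j) * inv (suc j)

  sumTo : (ℕ → Carrier) → ℕ → Carrier
  sumTo f zero    = f zero
  sumTo f (suc n) = sumTo f n + f (suc n)

{-# OPTIONS --safe #-}
-- Write L(n,m) for the left-hand side and C(n,m) = binom(m+n-λ, n). The sum on the right and
-- C satisfy Pascal's recurrence in (n, m), and so does L up to one extra term:
-- L(n+1,m+1) = L(n+1,m) + L(n,m+1) + binom(m+n+2, n+1) (H_{m+n+2} - H_{m+n+1}).
-- That extra term equals (H_{m+1} - H_m) C(n+1,m), which is exactly what Pascal's rule for
-- H_m C(n,m) leaves over, so the identity follows by double induction from the boundary
-- cases n = 0 and m = 0 (where the sum collapses to H_n).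
module Submission where

open import Defs
open import Level using (Level)
open import Algebra.Bundles using (CommutativeRing)
open import Data.Nat using (ℕ; zero; suc; _≤_; _<_; z≤n; s≤s)
import Data.Nat as N
open import Data.Nat.Base using (_!)
import Data.Nat.Properties as NP
open import Data.Integer as Z using (ℤ; +_; -[1+_])
import Data.Integer.Properties as ZP
open import Data.Maybe using (Maybe; just; nothing)
open import Relation.Nullary using (¬_; yes; no)
import Relation.Binary.PropositionalEquality as P

-- Algebra.Solver.Ring needs a coefficient ring mapping into R; ℤ does, and the tail-call
-- optimised multiple makes ⟦ + 1 ⟧ℤ definitionally 1#, as the `refl` given to `solve` requires.
module IntegerRingSolver {c ℓ : Level} (R : CommutativeRing c ℓ) where
  open CommutativeRing R hiding (zero)
  open import Algebra.Properties.Ring ring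
    using (-0#≈0#; -‿involutive; -‿+-comm; -‿distribˡ-*; -‿distribʳ-*)
  open import Algebra.Properties.Semiring.Mult.TCOptimised semiring
    using (_×_; 1+×; ×-homo-+; ×1-homo-*)
  open import Algebra.Solver.Ring.AlmostCommutativeRing
    using (fromCommutativeRing; _-Raw-AlmostCommutative⟶_)
  open import Relation.Binary.Reasoning.Setoid setoid

  ⟦_⟧ℤ : ℤ → Carrier
  ⟦ + n ⟧ℤ = n × 1#
  ⟦ -[1+ n ] ⟧ℤ = - (suc n × 1#)

  ⊖-homo : ∀ m n → ⟦ m Z.⊖ n ⟧ℤ ≈ m × 1# - n × 1#
  ⊖-homo zero zero = sym (-‿inverseʳ 0#)
  ⊖-homo zero (suc n) = sym (+-identityˡ _)
  ⊖-homo (suc m) zero = sym (trans (+-congˡ -0#≈0#) (+-identityʳ _))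
  ⊖-homo (suc m) (suc n) = begin
    ⟦ suc m Z.⊖ suc n ⟧ℤ            ≡⟨ P.cong ⟦_⟧ℤ (ZP.[1+m]⊖[1+n]≡m⊖n m n) ⟩
    ⟦ m Z.⊖ n ⟧ℤ                    ≈⟨ ⊖-homo m n ⟩
    m × 1# - n × 1#                 ≈⟨ +-congˡ (+-identityˡ _) ⟨
    m × 1# + (0# - n × 1#)          ≈⟨ +-congˡ (+-congʳ (-‿inverseʳ 1#)) ⟨
    m × 1# + ((1# - 1#) - n × 1#)   ≈⟨ +-congˡ (+-assoc _ _ _) ⟩
    m × 1# + (1# + (- 1# - n × 1#)) ≈⟨ +-assoc _ _ _ ⟨
    (m × 1# + 1#) + (- 1# - n × 1#) ≈⟨ +-cong (+-comm _ _) (-‿+-comm _ _) ⟩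
    (1# + m × 1#) - (1# + n × 1#)   ≈⟨ +-cong (1+× m 1#) (-‿cong (1+× n 1#)) ⟨
    suc m × 1# - suc n × 1#         ∎

  neg-homo : ∀ i → ⟦ Z.- i ⟧ℤ ≈ - ⟦ i ⟧ℤ
  neg-homo (+ zero) = sym -0#≈0#
  neg-homo (+ suc n) = refl
  neg-homo -[1+ n ] = sym (-‿involutive _)

  +-homo : ∀ i j → ⟦ i Z.+ j ⟧ℤ ≈ ⟦ i ⟧ℤ + ⟦ j ⟧ℤ
  +-homo (+ m) (+ n) = ×-homo-+ 1# m n
  +-homo (+ m) -[1+ n ] = ⊖-homo m (suc n)
  +-homo -[1+ m ] (+ n) = trans (⊖-homo n (suc m)) (+-comm _ _)
  +-homo -[1+ m ] -[1+ n ] = begin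
    - (suc (suc (m N.+ n)) × 1#)     ≡⟨ P.cong (λ k → - (k × 1#)) (P.sym (NP.+-suc (suc m) n)) ⟩
    - ((suc m N.+ suc n) × 1#)       ≈⟨ -‿cong (×-homo-+ 1# (suc m) (suc n)) ⟩
    - (suc m × 1# + suc n × 1#)      ≈⟨ -‿+-comm _ _ ⟨
    - (suc m × 1#) + - (suc n × 1#)  ∎

  ℕ*-homo : ∀ m n → ⟦ + m Z.* + n ⟧ℤ ≈ m × 1# * n × 1#
  ℕ*-homo m n = trans (reflexive (P.cong ⟦_⟧ℤ (P.sym (ZP.pos-* m n)))) (×1-homo-* m n)

  *-homo : ∀ i j → ⟦ i Z.* j ⟧ℤ ≈ ⟦ i ⟧ℤ * ⟦ j ⟧ℤ
  *-homo (+ m) (+ n) = ℕ*-homo m n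
  *-homo (+ m) -[1+ n ] = begin
    ⟦ + m Z.* -[1+ n ] ⟧ℤ          ≡⟨ P.cong ⟦_⟧ℤ (P.sym (ZP.neg-distribʳ-* (+ m) (+ suc n))) ⟩
    ⟦ Z.- (+ m Z.* + suc n) ⟧ℤ     ≈⟨ neg-homo (+ m Z.* + suc n) ⟩
    - ⟦ + m Z.* + suc n ⟧ℤ         ≈⟨ -‿cong (ℕ*-homo m (suc n)) ⟩
    - (m × 1# * suc n × 1#)        ≈⟨ -‿distribʳ-* _ _ ⟩
    m × 1# * - (suc n × 1#)        ∎
  *-homo -[1+ m ] (+ n) = begin
    ⟦ -[1+ m ] Z.* + n ⟧ℤ          ≡⟨ P.cong ⟦_⟧ℤ (P.sym (ZP.neg-distribˡ-* (+ suc m) (+ n))) ⟩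
    ⟦ Z.- (+ suc m Z.* + n) ⟧ℤ     ≈⟨ neg-homo (+ suc m Z.* + n) ⟩
    - ⟦ + suc m Z.* + n ⟧ℤ         ≈⟨ -‿cong (ℕ*-homo (suc m) n) ⟩
    - (suc m × 1# * n × 1#)        ≈⟨ -‿distribˡ-* _ _ ⟩
    - (suc m × 1#) * n × 1#        ∎
  *-homo -[1+ m ] -[1+ n ] = begin
    ⟦ -[1+ m ] Z.* -[1+ n ] ⟧ℤ           ≈⟨ ℕ*-homo (suc m) (suc n) ⟩
    suc m × 1# * suc n × 1#              ≈⟨ -‿involutive _ ⟨
    - - (suc m × 1# * suc n × 1#)        ≈⟨ -‿cong (-‿distribˡ-* _ _) ⟩
    - (- (suc m × 1#) * suc n × 1#)      ≈⟨ -‿distribʳ-* _ _ ⟩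
    - (suc m × 1#) * - (suc n × 1#)      ∎

  ⟦⟧ℤ-morphism :
    CommutativeRing.rawRing ZP.+-*-commutativeRing -Raw-AlmostCommutative⟶ fromCommutativeRing R
  ⟦⟧ℤ-morphism = record
    { ⟦_⟧ = ⟦_⟧ℤ ; +-homo = +-homo ; *-homo = *-homo ; -‿homo = neg-homo
    ; 0-homo = refl ; 1-homo = refl }

  ⟦⟧ℤ-≟ : ∀ i j → Maybe (⟦ i ⟧ℤ ≈ ⟦ j ⟧ℤ)
  ⟦⟧ℤ-≟ i j with i Z.≟ j
  ... | yes i≡j = just (reflexive (P.cong ⟦_⟧ℤ i≡j))
  ... | no _    = nothing

  open import Algebra.Solver.Ring _ _ ⟦⟧ℤ-morphism ⟦⟧ℤ-≟ public

module DegenerateHarmonicLemmas {c ℓ : Level} (R : CommutativeRing c ℓ)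
                                (inv : ℕ → CommutativeRing.Carrier R) where
  open CommutativeRing R hiding (zero)
  open Degenerate R inv
  open IntegerRingSolver R using (solve; Polynomial; con; _:+_; _:-_; _:*_; :-_; _:=_)
  open import Algebra.Properties.Semiring.Mult semiring using (_×_; ×1-homo-*)
  open import Relation.Binary.Reasoning.Setoid setoid

  one : ∀ {n} → Polynomial n
  one = con (+ 1)

  ι≡×1# : ∀ n → ι n P.≡ n × 1#
  ι≡×1# zero    = P.refl
  ι≡×1# (suc n) = P.cong (_+_ 1#) (ι≡×1# n)

  ι-* : ∀ m n → ι (m N.* n) ≈ ι m * ι n
  ι-* m n rewrite ι≡×1# (m N.* n) | ι≡×1# m | ι≡×1# n = ×1-homo-* m n

  *-inverse-unique : ∀ {x y z} → x * y ≈ 1# → x * z ≈ 1# → y ≈ z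
  *-inverse-unique {x} {y} {z} xy≈1 xz≈1 = begin
    y             ≈⟨ *-identityˡ y ⟨
    1# * y        ≈⟨ *-congʳ xz≈1 ⟨
    (x * z) * y   ≈⟨ solve 3 (λ x y z → (x :* z) :* y := (x :* y) :* z) refl x y z ⟩
    (x * y) * z   ≈⟨ *-congʳ xy≈1 ⟩
    1# * z        ≈⟨ *-identityˡ z ⟩
    z             ∎

  fall-cong : ∀ {x y} j → x ≈ y → fall x j ≈ fall y j
  fall-cong zero    x≈y = refl
  fall-cong (suc j) x≈y = *-cong (fall-cong j x≈y) (+-congʳ x≈y)

  binom-cong : ∀ {x y} j → x ≈ y → binom x j ≈ binom y j
  binom-cong j x≈y = *-congʳ (fall-cong j x≈y)

  fall-sucˡ : ∀ x j → fall x (suc j) ≈ x * fall (x - 1#) j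
  fall-sucˡ x zero    = solve 1 (λ x → one :* (x :- con (+ 0)) := x :* one) refl x
  fall-sucˡ x (suc j) = begin
    fall x (suc j) * (x - ι (suc j))           ≈⟨ *-congʳ (fall-sucˡ x j) ⟩
    (x * fall (x - 1#) j) * (x - (1# + ι j))
      ≈⟨ solve 3 (λ x F y → (x :* F) :* (x :- (one :+ y)) := x :* (F :* ((x :- one) :- y)))
               refl x (fall (x - 1#) j) (ι j) ⟩
    x * (fall (x - 1#) j * ((x - 1#) - ι j))   ∎

  fall-pascal : ∀ x j → fall (x + 1#) (suc j) ≈ fall x (suc j) + ι (suc j) * fall x j
  fall-pascal x zero    =
    solve 1 (λ x → one :* ((x :+ one) :- con (+ 0))
                 := one :* (x :- con (+ 0)) :+ (one :+ con (+ 0)) :* one) refl x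
  fall-pascal x (suc j) = begin
    fall (x + 1#) (suc j) * ((x + 1#) - ι (suc j))   ≈⟨ *-congʳ (fall-pascal x j) ⟩
    (F * (x - ι j) + (1# + ι j) * F) * ((x + 1#) - (1# + ι j))
      ≈⟨ solve 3 (λ F x y → (F :* (x :- y) :+ (one :+ y) :* F) :* ((x :+ one) :- (one :+ y))
                         := F :* (x :- y) :* (x :- (one :+ y)) :+ (one :+ (one :+ y)) :* (F :* (x :- y)))
               refl F x (ι j) ⟩
    (F * (x - ι j)) * (x - (1# + ι j)) + (1# + (1# + ι j)) * (F * (x - ι j)) ∎
    where F = fall x j

  fall-ι-! : ∀ k a → fall (ι (k N.+ a)) k * ι (a !) ≈ ι ((k N.+ a) !)
  fall-ι-! zero    a = *-identityˡ _
  fall-ι-! (suc k) a = begin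
    fall (ι (suc n)) (suc k) * ι (a !)               ≈⟨ *-congʳ (fall-sucˡ _ k) ⟩
    (ι (suc n) * fall (ι (suc n) - 1#) k) * ι (a !)  ≈⟨ *-congʳ (*-congˡ (fall-cong k ι[1+n]-1≈ι[n])) ⟩
    (ι (suc n) * fall (ι n) k) * ι (a !)             ≈⟨ *-assoc _ _ _ ⟩
    ι (suc n) * (fall (ι n) k * ι (a !))             ≈⟨ *-congˡ (fall-ι-! k a) ⟩
    ι (suc n) * ι (n !)                              ≈⟨ ι-* (suc n) (n !) ⟨
    ι (suc n !)                                      ∎
    where
    n = k N.+ a
    ι[1+n]-1≈ι[n] : ι (suc n) - 1# ≈ ι n
    ι[1+n]-1≈ι[n] = solve 1 (λ y → (one :+ y) :- one := y) refl (ι n)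

  fall-sgn-+ : ∀ x m k → fall (x - 1#) (m N.+ k) * sgn (m N.+ k)
                         ≈ (fall (x - 1#) m * sgn m) * fall (ι (m N.+ k) - x) k
  fall-sgn-+ x m zero    = begin
    fall (x - 1#) (m N.+ 0) * sgn (m N.+ 0)  ≡⟨ P.cong (λ j → fall (x - 1#) j * sgn j) (NP.+-identityʳ m) ⟩
    fall (x - 1#) m * sgn m                  ≈⟨ *-identityʳ _ ⟨
    (fall (x - 1#) m * sgn m) * 1#           ∎
  fall-sgn-+ x m (suc k) = begin
    fall (x - 1#) (m N.+ suc k) * sgn (m N.+ suc k)
      ≡⟨ P.cong (λ j → fall (x - 1#) j * sgn j) (NP.+-suc m k) ⟩
    (F * ((x - 1#) - y)) * (- s)
      ≈⟨ solve 4 (λ F s y x → (F :* ((x :- one) :- y)) :* (:- s) := (F :* s) :* ((one :+ y) :- x))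
               refl F s y x ⟩
    (F * s) * z                            ≈⟨ *-congʳ (fall-sgn-+ x m k) ⟩
    (T * fall (y - x) k) * z               ≈⟨ solve 3 (λ T G z → (T :* G) :* z := T :* (z :* G)) refl _ _ _ ⟩
    T * (z * fall (y - x) k)               ≈⟨ *-congˡ (*-congˡ (fall-cong k y-x≈z-1)) ⟩
    T * (z * fall (z - 1#) k)              ≈⟨ *-congˡ (fall-sucˡ z k) ⟨
    T * fall z (suc k)                     ≡⟨ P.cong (λ j → T * fall (ι j - x) (suc k)) (NP.+-suc m k) ⟨
    T * fall (ι (m N.+ suc k) - x) (suc k) ∎
    where
    F = fall (x - 1#) (m N.+ k)
    s = sgn (m N.+ k)
    y = ι (m N.+ k)
    z = (1# + y) - x
    T = fall (x - 1#) m * sgn m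
    y-x≈z-1 : y - x ≈ z - 1#
    y-x≈z-1 = solve 2 (λ y x → y :- x := ((one :+ y) :- x) :- one) refl y x

  binom-ι-suc : ∀ n → binom (ι n) (suc n) ≈ 0#
  binom-ι-suc n =
    solve 3 (λ F y I → (F :* (y :- y)) :* I := con (+ 0)) refl (fall (ι n) n) (ι n) (inv (suc n !))

  sumTo-cong : ∀ {f g} n → (∀ {l} → l ≤ n → f l ≈ g l) → sumTo f n ≈ sumTo g n
  sumTo-cong zero    f≈g = f≈g z≤n
  sumTo-cong (suc n) f≈g = +-cong (sumTo-cong n (λ l≤n → f≈g (NP.m≤n⇒m≤1+n l≤n))) (f≈g NP.≤-refl)

  sumTo-+ : ∀ f g n → sumTo (λ l → f l + g l) n ≈ sumTo f n + sumTo g n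
  sumTo-+ f g zero    = refl
  sumTo-+ f g (suc n) = begin
    sumTo (λ l → f l + g l) n + (f (suc n) + g (suc n)) ≈⟨ +-congʳ (sumTo-+ f g n) ⟩
    (sumTo f n + sumTo g n) + (f (suc n) + g (suc n))
      ≈⟨ solve 4 (λ a b c d → (a :+ b) :+ (c :+ d) := (a :+ c) :+ (b :+ d)) refl _ _ _ _ ⟩
    (sumTo f n + f (suc n)) + (sumTo g n + g (suc n))   ∎

  sumTo-zero : ∀ f n → (∀ {l} → l ≤ n → f l ≈ 0#) → sumTo f n ≈ 0#
  sumTo-zero f zero    f≈0 = f≈0 z≤n
  sumTo-zero f (suc n) f≈0 =
    trans (+-cong (sumTo-zero f n (λ l≤n → f≈0 (NP.m≤n⇒m≤1+n l≤n))) (f≈0 NP.≤-refl)) (+-identityʳ 0#)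

  sumTo-last : ∀ f n → (∀ {l} → l < n → f l ≈ 0#) → sumTo f n ≈ f n
  sumTo-last f zero    _   = refl
  sumTo-last f (suc n) f≈0 = trans (+-congʳ (sumTo-zero f n (λ l≤n → f≈0 (s≤s l≤n)))) (+-identityˡ _)

  conv : (ℕ → Carrier) → (ℕ → Carrier) → ℕ → Carrier
  conv a b n = sumTo (λ l → a l * b (n N.∸ l)) n

  conv-δ : ∀ a b n → b 0 ≈ 1# → (∀ d → b (suc d) ≈ 0#) → conv a b n ≈ a n
  conv-δ a b n b0≈1 b[1+d]≈0 = begin
    conv a b n         ≈⟨ sumTo-last _ n vanish ⟩
    a n * b (n N.∸ n)  ≡⟨ P.cong (λ d → a n * b d) (NP.n∸n≡0 n) ⟩
    a n * b 0          ≈⟨ *-congˡ b0≈1 ⟩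
    a n * 1#           ≈⟨ *-identityʳ (a n) ⟩
    a n                ∎
    where
    vanish : ∀ {l} → l < n → a l * b (n N.∸ l) ≈ 0#
    vanish {l} l<n rewrite NP.+-∸-assoc 1 l<n = trans (*-congˡ (b[1+d]≈0 (n N.∸ suc l))) (zeroʳ (a l))

  conv-pascal : ∀ a b b′ b″ n → (∀ d → b (suc d) ≈ b′ (suc d) + b″ d) → b 0 ≈ b′ 0 →
                conv a b (suc n) ≈ conv a b′ (suc n) + conv a b″ n
  conv-pascal a b b′ b″ n b-rec b0≈b′0 = begin
    sumTo (λ l → a l * b (suc n N.∸ l)) n + a (suc n) * b (n N.∸ n)
      ≈⟨ +-cong (sumTo-cong n split) (*-congˡ last) ⟩
    sumTo (λ l → a l * b′ (suc n N.∸ l) + a l * b″ (n N.∸ l)) n + a (suc n) * b′ (n N.∸ n)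
      ≈⟨ +-congʳ (sumTo-+ _ _ n) ⟩
    (sumTo (λ l → a l * b′ (suc n N.∸ l)) n + conv a b″ n) + a (suc n) * b′ (n N.∸ n)
      ≈⟨ solve 3 (λ x y z → (x :+ y) :+ z := (x :+ z) :+ y) refl _ _ _ ⟩
    conv a b′ (suc n) + conv a b″ n ∎
    where
    split : ∀ {l} → l ≤ n → a l * b (suc n N.∸ l) ≈ a l * b′ (suc n N.∸ l) + a l * b″ (n N.∸ l)
    split l≤n rewrite NP.+-∸-assoc 1 l≤n = trans (*-congˡ (b-rec _)) (distribˡ _ _ _)
    last : b (n N.∸ n) ≈ b′ (n N.∸ n)
    last rewrite NP.n∸n≡0 n = b0≈b′0

  module _ (ι-inv-suc : ∀ k → ι (suc k) * inv (suc k) ≈ 1#) where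

    ι-inv-! : ∀ n → ι (n !) * inv (n !) ≈ 1#
    ι-inv-! n = P.subst (λ k → ι k * inv k ≈ 1#) (NP.suc-pred (n !) {{n NP.!≢0}}) (ι-inv-suc _)

    inv-! : ∀ j → inv (suc j !) ≈ inv (suc j) * inv (j !)
    inv-! j = *-inverse-unique (ι-inv-! (suc j)) (begin
      ι (suc j N.* j !) * (inv (suc j) * inv (j !))       ≈⟨ *-congʳ (ι-* (suc j) (j !)) ⟩
      (ι (suc j) * ι (j !)) * (inv (suc j) * inv (j !))
        ≈⟨ solve 4 (λ a b c d → (a :* b) :* (c :* d) := (a :* c) :* (b :* d)) refl _ _ _ _ ⟩
      (ι (suc j) * inv (suc j)) * (ι (j !) * inv (j !))   ≈⟨ *-cong (ι-inv-suc j) (ι-inv-! j) ⟩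
      1# * 1#                                             ≈⟨ *-identityˡ 1# ⟩
      1#                                                  ∎)

    fall-ι-inv-! : ∀ k a → fall (ι (k N.+ a)) k * inv ((k N.+ a) !) ≈ inv (a !)
    fall-ι-inv-! k a = *-inverse-unique (begin
      ι (a !) * (fall (ι (k N.+ a)) k * inv ((k N.+ a) !))
        ≈⟨ solve 3 (λ x y z → x :* (y :* z) := (y :* x) :* z) refl _ _ _ ⟩
      (fall (ι (k N.+ a)) k * ι (a !)) * inv ((k N.+ a) !)  ≈⟨ *-congʳ (fall-ι-! k a) ⟩
      ι ((k N.+ a) !) * inv ((k N.+ a) !)                   ≈⟨ ι-inv-! (k N.+ a) ⟩
      1#                                                    ∎) (ι-inv-! a)

    binom-zero : ∀ x → binom x 0 ≈ 1#
    binom-zero x = trans (*-identityˡ (inv 1))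
                         (*-inverse-unique (ι-inv-suc 0) (trans (*-identityʳ _) (+-identityʳ 1#)))

    binom-pascal : ∀ x j → binom (x + 1#) (suc j) ≈ binom x (suc j) + binom x j
    binom-pascal x j = begin
      fall (x + 1#) (suc j) * inv (suc j !)                     ≈⟨ *-congʳ (fall-pascal x j) ⟩
      (fall x (suc j) + ι (suc j) * fall x j) * inv (suc j !)
        ≈⟨ solve 4 (λ A y F I → (A :+ y :* F) :* I := A :* I :+ F :* (y :* I)) refl _ _ _ _ ⟩
      binom x (suc j) + fall x j * (ι (suc j) * inv (suc j !))  ≈⟨ +-congˡ (*-congˡ ι[1+j]/[1+j]!≈1/j!) ⟩
      binom x (suc j) + binom x j                               ∎
      where
      ι[1+j]/[1+j]!≈1/j! : ι (suc j) * inv (suc j !) ≈ inv (j !)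
      ι[1+j]/[1+j]!≈1/j! = begin
        ι (suc j) * inv (suc j !)               ≈⟨ *-congˡ (inv-! j) ⟩
        ι (suc j) * (inv (suc j) * inv (j !))   ≈⟨ *-assoc _ _ _ ⟨
        (ι (suc j) * inv (suc j)) * inv (j !)   ≈⟨ *-congʳ (ι-inv-suc j) ⟩
        1# * inv (j !)                          ≈⟨ *-identityˡ _ ⟩
        inv (j !)                               ∎

    binom-ι-diag : ∀ n → binom (ι n) n ≈ 1#
    binom-ι-diag zero    = binom-zero 0#
    binom-ι-diag (suc n) = begin
      binom (1# + ι n) (suc n)             ≈⟨ binom-cong (suc n) (+-comm _ _) ⟩
      binom (ι n + 1#) (suc n)             ≈⟨ binom-pascal (ι n) n ⟩
      binom (ι n) (suc n) + binom (ι n) n  ≈⟨ +-cong (binom-ι-suc n) (binom-ι-diag n) ⟩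
      0# + 1#                              ≈⟨ +-identityˡ _ ⟩
      1#                                   ∎

    module _ (lam : Carrier) where

      -- coeff m (n - l) is the paper's binom(m+n-l-1, n-l).
      coeff : ℕ → ℕ → Carrier
      coeff m d = binom (ι (m N.+ d) - 1#) d

      coeff-pascal : ∀ m d → coeff (suc m) (suc d) ≈ coeff m (suc d) + coeff (suc m) d
      coeff-pascal m d = begin
        binom ((1# + ι (m N.+ suc d)) - 1#) (suc d)
          ≈⟨ binom-cong (suc d) (solve 1 (λ y → (one :+ y) :- one := (y :- one) :+ one) refl _) ⟩
        binom ((ι (m N.+ suc d) - 1#) + 1#) (suc d)        ≈⟨ binom-pascal _ d ⟩
        coeff m (suc d) + binom (ι (m N.+ suc d) - 1#) d
          ≡⟨ P.cong (λ j → coeff m (suc d) + binom (ι j - 1#) d) (NP.+-suc m d) ⟩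
        coeff m (suc d) + coeff (suc m) d                  ∎

      coeff-zero-suc : ∀ d → coeff 0 (suc d) ≈ 0#
      coeff-zero-suc d =
        trans (binom-cong (suc d) (solve 1 (λ y → (one :+ y) :- one := y) refl (ι d))) (binom-ι-suc d)

      sumTo≈conv : ∀ n m → sumTo (λ l → H lam l * binom (ι (m N.+ n N.∸ l) - 1#) (n N.∸ l)) n
                           ≈ conv (H lam) (coeff m) n
      sumTo≈conv n m = sumTo-cong n λ {l} l≤n →
        reflexive (P.cong (λ j → H lam l * binom (ι j - 1#) (n N.∸ l)) (NP.+-∸-assoc m l≤n))

      L : ℕ → ℕ → Carrier
      L n m = binom (ι (n N.+ m)) n * H lam (n N.+ m)

      C : ℕ → ℕ → Carrier
      C n m = binom (ι (m N.+ n) - lam) n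

      ΔH : ℕ → Carrier
      ΔH j = (binom (lam - 1#) j * sgn j) * inv (suc j)

      -- Both sides are (-1)^m (λ-1)^(m falling) (m+k-λ)^(k falling) / (k! (m+1)!).
      binom*ΔH≈ΔH*C : ∀ m k → binom (ι (suc (m N.+ k))) k * ΔH (m N.+ k) ≈ ΔH m * C k m
      binom*ΔH≈ΔH*C m k = begin
        (A * inv (k !)) * (((F * inv (j !)) * sgn j) * inv (suc j))
          ≈⟨ solve 6 (λ A Ik F Ij s i → (A :* Ik) :* (((F :* Ij) :* s) :* i)
                                      := ((A :* (Ij :* i)) :* (F :* s)) :* Ik) refl _ _ _ _ _ _ ⟩
        ((A * (inv (j !) * inv (suc j))) * (F * sgn j)) * inv (k !)
          ≈⟨ *-congʳ (*-cong (*-congˡ (trans (*-comm _ _) (sym (inv-! j)))) (fall-sgn-+ lam m k)) ⟩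
        ((A * inv (suc j !)) * (Tm * G)) * inv (k !)
          ≡⟨ P.cong (λ i → ((fall (ι i) k * inv (i !)) * (Tm * G)) * inv (k !)) (NP.+-comm (suc m) k) ⟩
        ((fall (ι (k N.+ suc m)) k * inv ((k N.+ suc m) !)) * (Tm * G)) * inv (k !)
          ≈⟨ *-congʳ (*-congʳ (trans (fall-ι-inv-! k (suc m)) (inv-! m))) ⟩
        ((inv (suc m) * inv (m !)) * ((Fm * sgn m) * G)) * inv (k !)
          ≈⟨ solve 6 (λ i Im F s G Ik → ((i :* Im) :* ((F :* s) :* G)) :* Ik
                                      := (((F :* Im) :* s) :* i) :* (G :* Ik)) refl _ _ _ _ _ _ ⟩
        ΔH m * C k m ∎
        where
        j = m N.+ k
        A = fall (ι (suc j)) k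
        F = fall (lam - 1#) j
        Fm = fall (lam - 1#) m
        Tm = Fm * sgn m
        G = fall (ι j - lam) k

      L-pascal : ∀ n m → L (suc n) (suc m) ≈ (L (suc n) m + L n (suc m))
                                             + binom (ι (suc (m N.+ suc n))) (suc n) * ΔH (m N.+ suc n)
      L-pascal n m = begin
        binom (ι (suc t)) (suc n) * (H lam t + ΔH t)
          ≈⟨ distribˡ _ _ _ ⟩
        binom (1# + ι t) (suc n) * H lam t + binom (ι (suc t)) (suc n) * ΔH t
          ≈⟨ +-congʳ (*-congʳ (trans (binom-cong (suc n) (+-comm 1# (ι t))) (binom-pascal (ι t) n))) ⟩
        (binom (ι t) (suc n) + binom (ι t) n) * H lam t + binom (ι (suc t)) (suc n) * ΔH t
          ≈⟨ +-congʳ (distribʳ _ _ _) ⟩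
        (binom (ι t) (suc n) * H lam t + L n (suc m)) + binom (ι (suc t)) (suc n) * ΔH t
          ≡⟨ P.cong₂ (λ i i′ → (binom (ι i) (suc n) * H lam i + L n (suc m))
                                + binom (ι (suc i′)) (suc n) * ΔH i′)
                     (NP.+-suc n m) (P.trans (NP.+-suc n m) (NP.+-comm (suc n) m)) ⟩
        (L (suc n) m + L n (suc m)) + binom (ι (suc (m N.+ suc n))) (suc n) * ΔH (m N.+ suc n) ∎
        where t = n N.+ suc m

      C-pascal : ∀ n m → C (suc n) (suc m) ≈ C (suc n) m + C n (suc m)
      C-pascal n m = begin
        binom ((1# + ι (m N.+ suc n)) - lam) (suc n)
          ≈⟨ binom-cong (suc n) (solve 2 (λ y x → (one :+ y) :- x := (y :- x) :+ one) refl _ lam) ⟩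
        binom ((ι (m N.+ suc n) - lam) + 1#) (suc n)  ≈⟨ binom-pascal _ n ⟩
        C (suc n) m + binom (ι (m N.+ suc n) - lam) n
          ≡⟨ P.cong (λ i → C (suc n) m + binom (ι i - lam) n) (NP.+-suc m n) ⟩
        C (suc n) m + C n (suc m)                     ∎

      L≈conv+H*C : ∀ n m → L n m ≈ conv (H lam) (coeff m) n + H lam m * C n m
      L≈conv+H*C zero m = solve 2 (λ b h → b :* h := con (+ 0) :* b :+ h :* b) refl (binom 0# 0) (H lam m)
      L≈conv+H*C (suc n) zero = begin
        binom (ι (suc n N.+ 0)) (suc n) * H lam (suc n N.+ 0)
          ≡⟨ P.cong (λ i → binom (ι i) (suc n) * H lam i) (NP.+-identityʳ (suc n)) ⟩
        binom (ι (suc n)) (suc n) * H lam (suc n)          ≈⟨ *-congʳ (binom-ι-diag (suc n)) ⟩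
        1# * H lam (suc n)                                 ≈⟨ *-identityˡ _ ⟩
        H lam (suc n)
          ≈⟨ conv-δ (H lam) (coeff 0) (suc n) (binom-zero (0# - 1#)) coeff-zero-suc ⟨
        conv (H lam) (coeff 0) (suc n)                     ≈⟨ +-identityʳ _ ⟨
        conv (H lam) (coeff 0) (suc n) + 0#                ≈⟨ +-congˡ (zeroˡ _) ⟨
        conv (H lam) (coeff 0) (suc n) + 0# * C (suc n) 0  ∎
      L≈conv+H*C (suc n) (suc m) = begin
        L (suc n) (suc m)
          ≈⟨ L-pascal n m ⟩
        (L (suc n) m + L n (suc m)) + binom (ι (suc (m N.+ suc n))) (suc n) * ΔH (m N.+ suc n)
          ≈⟨ +-cong (+-cong (L≈conv+H*C (suc n) m) (L≈conv+H*C n (suc m)))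
                    (binom*ΔH≈ΔH*C m (suc n)) ⟩
        ((S₁ + H lam m * C₁) + (S₂ + H lam (suc m) * C₂)) + ΔH m * C₁
          ≈⟨ solve 6 (λ S₁ h C₁ S₂ δ C₂ →
                        ((S₁ :+ h :* C₁) :+ (S₂ :+ (h :+ δ) :* C₂)) :+ δ :* C₁
                        := (S₁ :+ S₂) :+ (h :+ δ) :* (C₁ :+ C₂))
                   refl S₁ (H lam m) C₁ S₂ (ΔH m) C₂ ⟩
        (S₁ + S₂) + H lam (suc m) * (C₁ + C₂)
          ≈⟨ +-cong (conv-pascal (H lam) (coeff (suc m)) (coeff m) (coeff (suc m)) n (coeff-pascal m) refl)
                    (*-congˡ (C-pascal n m)) ⟨
        conv (H lam) (coeff (suc m)) (suc n) + H lam (suc m) * C (suc n) (suc m) ∎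
        where
        S₁ = conv (H lam) (coeff m) (suc n)
        S₂ = conv (H lam) (coeff (suc m)) n
        C₁ = C (suc n) m
        C₂ = C n (suc m)

theorem2p3 : {c ℓ : Level} (R : CommutativeRing c ℓ) (inv : ℕ → CommutativeRing.Carrier R) →
    let open CommutativeRing R
        open Degenerate R inv
    in (∀ k → ι (suc k) * inv (suc k) ≈ 1#) →
       (lam : Carrier) → ¬ (lam ≈ 0#) →
       (m n : ℕ) →
       binom (ι (n N.+ m)) n * H lam (n N.+ m)
         ≈ sumTo (λ l → H lam l * binom (ι (m N.+ n N.∸ l) - 1#) (n N.∸ l)) n
           + H lam m * binom (ι (m N.+ n) - lam) n
theorem2p3 R inv ι-inv-suc lam _ m n =
  trans (L≈conv+H*C ι-inv-suc lam n m) (+-congʳ (sym (sumTo≈conv ι-inv-suc lam n m)))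
  where
  open CommutativeRing R
  open DegenerateHarmonicLemmas R inv
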